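{- For every $n\geq 2$, $\mathrm{MEG}(Q_n)=2^n$, where $Q_n$ is the hypercube of dimension $n$.
   Context: $Q_n$ has vertex set $\{0,1\}^n$ (equivalently labels $0,\dots,2^n-1$ in binary), with two vertices adjacent iff their binary representations differ in exactly one bit. Two vertices $x,y$ of a graph $G$ monitor an edge $e$ if $e$ belongs to all shortest paths between $x$ and $y$. A set $S\subseteq V(G)$ is a monitoring edge-geodetic set (MEG-set) if for every edge $e$ of $G$ there is a pair $x,y\in S$ that monitors $e$. $\mathrm{MEG}(G)$ denotes the minimum size of an MEG-set of $G$. -}

module Defs where

open import Level using (Level; _⊔_) renaming (suc to lsuc)
open import Data.Nat using (ℕ; zero; suc; _≤_; _^_)
open import Data.Bool using (Bool)
open import Data.Fin using (Fin)
open import Data.Vec using (Vec; lookup)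
open import Data.List using (List; length)
open import Data.List.Membership.Propositional using (_∈_)
open import Data.List.Relation.Unary.Unique.Propositional using (Unique)
open import Data.Product using (Σ; ∃; _×_)
open import Relation.Binary.PropositionalEquality using (_≡_; _≢_)

record Graph (a ℓ : Level) : Set (lsuc (a ⊔ ℓ)) where
  field
    Vertex : Set a
    Adj    : Vertex → Vertex → Set ℓ

module _ {a ℓ} (G : Graph a ℓ) where
  open Graph G

  data Walk : Vertex → Vertex → ℕ → Set (a ⊔ ℓ) where
    nil  : ∀ {x} → Walk x x 0
    cons : ∀ {x z y k} → Adj x z → Walk z y k → Walk x y (suc k)

  data EdgeIn (u v : Vertex) : ∀ {x y k} → Walk x y k → Set (a ⊔ ℓ) where
    here→ : ∀ {y k} (e : Adj u v) (w : Walk v y k) → EdgeIn u v (cons e w)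
    here← : ∀ {y k} (e : Adj v u) (w : Walk u y k) → EdgeIn u v (cons e w)
    there : ∀ {x z y k} (e : Adj x z) {w : Walk z y k} → EdgeIn u v w → EdgeIn u v (cons e w)

  IsShortest : ∀ {x y k} → Walk x y k → Set (a ⊔ ℓ)
  IsShortest {x} {y} {k} _ = ∀ k' → Walk x y k' → k ≤ k'

  Monitors : Vertex → Vertex → Vertex → Vertex → Set (a ⊔ ℓ)
  Monitors x y u v = ∀ k (w : Walk x y k) → IsShortest w → EdgeIn u v w

  IsMEGSet : List Vertex → Set (a ⊔ ℓ)
  IsMEGSet S = ∀ u v → Adj u v →
    Σ Vertex λ x → Σ Vertex λ y → x ∈ S × y ∈ S × Monitors x y u v

  MEG≡ : ℕ → Set (a ⊔ ℓ)
  MEG≡ m = (Σ (List Vertex) λ S → Unique S × IsMEGSet S × length S ≡ m)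
         × (∀ S → Unique S → IsMEGSet S → m ≤ length S)

HypercubeAdj : ∀ n → Vec Bool n → Vec Bool n → Set
HypercubeAdj n x y = Σ (Fin n) λ i →
  lookup x i ≢ lookup y i × (∀ j → j ≢ i → lookup x j ≡ lookup y j)

Q : ℕ → Graph _ _
Q n = record { Vertex = Vec Bool n ; Adj = HypercubeAdj n }

{-# OPTIONS --safe #-}
-- In any graph without isolated vertices in which an edge can only be monitored by a pair
-- containing one of its endpoints, every MEG-set contains all vertices, and the vertex set
-- itself is one (each edge is monitored by its own endpoints). The hypercube is such a graph:
-- by induction on the Hamming distance of x and y, a vertex u ∉ {x, y} on every geodesic must
-- be the first step x + eᵢ of a geodesic for every coordinate i where x and y differ, and two
-- such coordinates give distinct first steps.
module Submission where

open import Defs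
open import Data.Bool using (Bool; true; false; not; _xor_; if_then_else_)
open import Data.Bool.Properties using (¬-not; not-¬) renaming (_≟_ to _≟ᵇ_)
open import Data.Empty using (⊥-elim)
open import Data.Fin using (Fin; zero; suc) renaming (_≟_ to _≟ᶠ_)
open import Data.List using (List; []; _∷_; _++_; map; length)
open import Data.List.Properties using (length-++; length-map)
open import Data.List.Membership.Propositional using (_∈_)
open import Data.List.Membership.Propositional.Properties
  using (∈-map⁺; ∈-map⁻; ∈-++⁺ˡ; ∈-++⁺ʳ; ∈-++⁻; ∈-∃++)
open import Data.List.Relation.Binary.Subset.Propositional using (_⊆_)
open import Data.List.Relation.Unary.All as All using ()
open import Data.List.Relation.Unary.AllPairs using ([]; _∷_)
open import Data.List.Relation.Unary.Any using (here; there)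
open import Data.List.Relation.Unary.Unique.Propositional using (Unique)
import Data.List.Relation.Unary.Unique.Propositional.Properties as Unique
open import Data.Nat using (ℕ; zero; suc; _+_; _≤_; _^_; z≤n; s≤s)
open import Data.Nat.Properties
  using (≤-refl; ≤-trans; ≤-reflexive; +-suc; +-identityʳ; suc-injective; m≤n+m; module ≤-Reasoning)
open import Data.Product using (∃; _×_; _,_)
open import Data.Sum using (_⊎_; inj₁; inj₂; [_,_])
open import Data.Vec using (Vec; []; _∷_; lookup; updateAt; tabulate)
open import Data.Vec.Properties
  using (lookup∘updateAt; lookup∘updateAt′; tabulate∘lookup; tabulate-cong; ∷-injectiveʳ)
  renaming (≡-dec to ≡-decᵛ)
open import Level using (Level)
open import Relation.Binary.Definitions using (DecidableEquality)
open import Relation.Binary.PropositionalEquality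
  using (_≡_; _≢_; refl; sym; trans; cong; cong₂; subst; module ≡-Reasoning)
open import Relation.Nullary using (¬_; yes; no; contradiction)

Unique-⊆⇒length-≤ : ∀ {a} {A : Set a} {xs ys : List A} → Unique xs → xs ⊆ ys → length xs ≤ length ys
Unique-⊆⇒length-≤ {xs = []} _ _ = z≤n
Unique-⊆⇒length-≤ {xs = x ∷ xs} (x∉xs ∷ xs-unique) xs⊆ys with ∈-∃++ (xs⊆ys (here refl))
... | as , bs , refl = begin
  suc (length xs)             ≤⟨ s≤s (Unique-⊆⇒length-≤ xs-unique xs⊆as++bs) ⟩
  suc (length (as ++ bs))     ≡⟨ cong suc (length-++ as) ⟩
  suc (length as + length bs) ≡⟨ +-suc (length as) (length bs) ⟨
  length as + length (x ∷ bs) ≡⟨ length-++ as ⟨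
  length (as ++ x ∷ bs)       ∎
  where
  open ≤-Reasoning
  xs⊆as++bs : xs ⊆ as ++ bs
  xs⊆as++bs v∈xs with ∈-++⁻ as (xs⊆ys (there v∈xs))
  ... | inj₁ v∈as = ∈-++⁺ˡ v∈as
  ... | inj₂ (here refl) = contradiction refl (All.lookup x∉xs v∈xs)
  ... | inj₂ (there v∈bs) = ∈-++⁺ʳ as v∈bs

module _ {a ℓ : Level} (G : Graph a ℓ) where
  open Graph G

  ¬EdgeIn-nil : ∀ {x u v} → ¬ EdgeIn G u v (nil {x = x})
  ¬EdgeIn-nil ()

  EdgeIn-cons⁻ : ∀ {u v x z y k} {e : Adj x z} {w : Walk G z y k} →
                 u ≢ x → u ≢ z → EdgeIn G u v (cons e w) → EdgeIn G u v w
  EdgeIn-cons⁻ u≢x _   (here→ _ _) = contradiction refl u≢x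
  EdgeIn-cons⁻ _   u≢z (here← _ _) = contradiction refl u≢z
  EdgeIn-cons⁻ _   _   (there _ p) = p

  Monitors-adjacent : ∀ {u v} → Adj u v → u ≢ v → Monitors G u v u v
  Monitors-adjacent _ u≢v _ nil                 _        = contradiction refl u≢v
  Monitors-adjacent _ _   _ (cons e nil)        _        = here→ e nil
  Monitors-adjacent e _   _ (cons _ (cons _ _)) shortest with shortest 1 (cons e nil)
  ... | s≤s ()

  -- The middle hypotheses say that the edge x z starts a geodesic from x to y.
  Monitors-tail : ∀ {x z y u v d} → Adj x z → Walk G z y d → (∀ k → Walk G x y k → suc d ≤ k) →
                  Monitors G x y u v → u ≢ x → u ≢ z → Monitors G z y u v
  Monitors-tail e geodesic far mon u≢x u≢z k w w-shortest =
    EdgeIn-cons⁻ u≢x u≢z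
      (mon (suc k) (cons e w) λ k′ w′ → ≤-trans (s≤s (w-shortest _ geodesic)) (far k′ w′))

  module _ (irreflexive : ∀ {u v} → Adj u v → u ≢ v) (no-isolated : ∀ u → ∃ (Adj u))
           (monitored-by-endpoint : ∀ {x y u v} → Monitors G x y u v → u ≡ x ⊎ u ≡ y) where

    IsMEGSet-complete : ∀ {V} → (∀ u → u ∈ V) → IsMEGSet G V
    IsMEGSet-complete complete u v e = u , v , complete u , complete v , Monitors-adjacent e (irreflexive e)

    IsMEGSet⇒complete : ∀ {S} → IsMEGSet G S → ∀ u → u ∈ S
    IsMEGSet⇒complete meg u with no-isolated u
    ... | v , e with meg u v e
    ...   | x , y , x∈S , y∈S , mon with monitored-by-endpoint mon
    ...     | inj₁ refl = x∈S
    ...     | inj₂ refl = y∈S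

    MEG≡-length : ∀ {V} → Unique V → (∀ u → u ∈ V) → MEG≡ G (length V)
    MEG≡-length V-unique complete =
      (_ , V-unique , IsMEGSet-complete complete , refl) ,
      λ S _ meg → Unique-⊆⇒length-≤ V-unique (λ {u} _ → IsMEGSet⇒complete meg u)

≢⇒differ-at : ∀ {a} {A : Set a} {n} → DecidableEquality A →
              {x y : Vec A n} → x ≢ y → ∃ λ i → lookup x i ≢ lookup y i
≢⇒differ-at _≟_ {[]} {[]} x≢y = contradiction refl x≢y
≢⇒differ-at _≟_ {a ∷ x} {b ∷ y} a∷x≢b∷y with a ≟ b
... | no a≢b = zero , a≢b
... | yes refl with ≢⇒differ-at _≟_ (λ x≡y → a∷x≢b∷y (cong (a ∷_) x≡y))
...   | i , xᵢ≢yᵢ = suc i , xᵢ≢yᵢ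

lookup-ext : ∀ {a} {A : Set a} {n} {x y : Vec A n} → (∀ i → lookup x i ≡ lookup y i) → x ≡ y
lookup-ext {x = x} {y} x≗y = begin
  x                   ≡⟨ tabulate∘lookup x ⟨
  tabulate (lookup x) ≡⟨ tabulate-cong x≗y ⟩
  tabulate (lookup y) ≡⟨ tabulate∘lookup y ⟩
  y                   ∎
  where open ≡-Reasoning

private
  variable
    n d : ℕ
    x y : Vec Bool n
    i j : Fin n

flipAt : Fin n → Vec Bool n → Vec Bool n
flipAt i x = updateAt x i not

flipAt-adjacent : ∀ i (x : Vec Bool n) → HypercubeAdj n x (flipAt i x)
flipAt-adjacent i x =
  i , (λ xᵢ≡flipᵢ → not-¬ refl (trans xᵢ≡flipᵢ (lookup∘updateAt i x))) ,
  (λ j j≢i → sym (lookup∘updateAt′ j i j≢i x))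

adjacent⇒flipAt : HypercubeAdj n x y → ∃ λ i → x ≡ flipAt i y
adjacent⇒flipAt {x = x} {y} (i , xᵢ≢yᵢ , x≗y-elsewhere) = i , lookup-ext agree
  where
  agree : ∀ j → lookup x j ≡ lookup (flipAt i y) j
  agree j with j ≟ᶠ i
  ... | yes refl = trans (¬-not xᵢ≢yᵢ) (sym (lookup∘updateAt i y))
  ... | no j≢i = trans (x≗y-elsewhere j j≢i) (sym (lookup∘updateAt′ j i j≢i y))

adjacent-irreflexive : HypercubeAdj n x y → x ≢ y
adjacent-irreflexive (_ , xᵢ≢yᵢ , _) refl = xᵢ≢yᵢ refl

flipAt-fixes-difference : lookup x i ≢ lookup y i → lookup (flipAt i x) i ≡ lookup y i
flipAt-fixes-difference {x = x} {i = i} xᵢ≢yᵢ =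
  trans (lookup∘updateAt i x) (sym (¬-not (λ yᵢ≡xᵢ → xᵢ≢yᵢ (sym yᵢ≡xᵢ))))

flipAt-injectiveˡ : ∀ (x : Vec Bool n) → flipAt i x ≡ flipAt j x → i ≡ j
flipAt-injectiveˡ {i = i} {j} x flipᵢ≡flipⱼ with i ≟ᶠ j
... | yes i≡j = i≡j
... | no i≢j = contradiction
  (trans (sym (lookup∘updateAt′ j i (λ j≡i → i≢j (sym j≡i)) x))
         (trans (cong (λ z → lookup z j) flipᵢ≡flipⱼ) (lookup∘updateAt j x)))
  (not-¬ refl)

another-difference : lookup x i ≢ lookup y i → flipAt i x ≢ y →
                     ∃ λ j → i ≢ j × lookup x j ≢ lookup y j
another-difference {x = x} {i} {y} xᵢ≢yᵢ flipᵢ≢y with ≢⇒differ-at _≟ᵇ_ {x = flipAt i x} {y} flipᵢ≢y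
... | j , flipᵢⱼ≢yⱼ with i ≟ᶠ j
...   | yes refl = contradiction (flipAt-fixes-difference {x = x} {y = y} xᵢ≢yᵢ) flipᵢⱼ≢yⱼ
...   | no i≢j = j , i≢j , λ xⱼ≡yⱼ →
  flipᵢⱼ≢yⱼ (trans (lookup∘updateAt′ j i (λ j≡i → i≢j (sym j≡i)) x) xⱼ≡yⱼ)

hamming : Vec Bool n → Vec Bool n → ℕ
hamming []      []      = 0
hamming (a ∷ x) (b ∷ y) = if a xor b then suc (hamming x y) else hamming x y

hamming-self : ∀ (x : Vec Bool n) → hamming x x ≡ 0
hamming-self []          = refl
hamming-self (true ∷ x)  = hamming-self x
hamming-self (false ∷ x) = hamming-self x

hamming≡0⇒≡ : ∀ (x y : Vec Bool n) → hamming x y ≡ 0 → x ≡ y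
hamming≡0⇒≡ []          []          _ = refl
hamming≡0⇒≡ (true ∷ x)  (true ∷ y)  h = cong (true ∷_) (hamming≡0⇒≡ x y h)
hamming≡0⇒≡ (false ∷ x) (false ∷ y) h = cong (false ∷_) (hamming≡0⇒≡ x y h)

hamming≡suc⇒differ-at : ∀ (x y : Vec Bool n) → hamming x y ≡ suc d → ∃ λ i → lookup x i ≢ lookup y i
hamming≡suc⇒differ-at x y h =
  ≢⇒differ-at _≟ᵇ_ {x = x} {y} λ { refl → contradiction (trans (sym (hamming-self x)) h) λ () }

hamming-flipAt-≤ : ∀ i (x y : Vec Bool n) → hamming (flipAt i x) y ≤ suc (hamming x y)
hamming-flipAt-≤ zero    (true ∷ x)  (true ∷ y)  = ≤-refl
hamming-flipAt-≤ zero    (true ∷ x)  (false ∷ y) = m≤n+m _ 2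
hamming-flipAt-≤ zero    (false ∷ x) (true ∷ y)  = m≤n+m _ 2
hamming-flipAt-≤ zero    (false ∷ x) (false ∷ y) = ≤-refl
hamming-flipAt-≤ (suc i) (a ∷ x)     (b ∷ y)     with a xor b
... | true  = s≤s (hamming-flipAt-≤ i x y)
... | false = hamming-flipAt-≤ i x y

hamming-flipAt-differ : ∀ i (x y : Vec Bool n) → lookup x i ≢ lookup y i →
                        suc (hamming (flipAt i x) y) ≡ hamming x y
hamming-flipAt-differ zero    (true ∷ x)  (true ∷ y)  xᵢ≢yᵢ = contradiction refl xᵢ≢yᵢ
hamming-flipAt-differ zero    (true ∷ x)  (false ∷ y) _     = refl
hamming-flipAt-differ zero    (false ∷ x) (true ∷ y)  _     = refl
hamming-flipAt-differ zero    (false ∷ x) (false ∷ y) xᵢ≢yᵢ = contradiction refl xᵢ≢yᵢ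
hamming-flipAt-differ (suc i) (a ∷ x)     (b ∷ y)     xᵢ≢yᵢ with a xor b
... | true  = cong suc (hamming-flipAt-differ i x y xᵢ≢yᵢ)
... | false = hamming-flipAt-differ i x y xᵢ≢yᵢ

hamming-flipAt-pred : ∀ i (x y : Vec Bool n) → lookup x i ≢ lookup y i →
                      hamming x y ≡ suc d → hamming (flipAt i x) y ≡ d
hamming-flipAt-pred i x y xᵢ≢yᵢ h = suc-injective (trans (hamming-flipAt-differ i x y xᵢ≢yᵢ) h)

hamming≤length : ∀ {k} → Walk (Q n) x y k → hamming x y ≤ k
hamming≤length {x = x} nil = ≤-reflexive (hamming-self x)
hamming≤length {x = x} {y} (cons {z = z} e w) with adjacent⇒flipAt {x = x} {z} e
... | i , refl = ≤-trans (hamming-flipAt-≤ i z y) (s≤s (hamming≤length w))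

geodesic : ∀ d {x y : Vec Bool n} → hamming x y ≡ d → Walk (Q n) x y d
geodesic zero    {x} {y} h = subst (λ y → Walk (Q _) x y 0) (hamming≡0⇒≡ x y h) nil
geodesic (suc d) {x} {y} h with hamming≡suc⇒differ-at x y h
... | i , xᵢ≢yᵢ =
  cons {z = flipAt i x} (flipAt-adjacent i x) (geodesic d (hamming-flipAt-pred i x y xᵢ≢yᵢ h))

Monitors-flipAt : ∀ {x y u v : Vec Bool n} i → lookup x i ≢ lookup y i → Monitors (Q n) x y u v →
                  u ≢ x → u ≢ flipAt i x → Monitors (Q n) (flipAt i x) y u v
Monitors-flipAt {x = x} {y} i xᵢ≢yᵢ =
  Monitors-tail (Q _) (flipAt-adjacent i x) (geodesic _ refl)
    λ k w → subst (_≤ k) (sym (hamming-flipAt-differ i x y xᵢ≢yᵢ)) (hamming≤length w)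

Monitors⇒endpoint : ∀ d {x y u v : Vec Bool n} → hamming x y ≡ d →
                    Monitors (Q n) x y u v → u ≡ x ⊎ u ≡ y
Monitors⇒endpoint zero {x} {y} h mon with hamming≡0⇒≡ x y h
... | refl = contradiction (mon 0 nil λ _ _ → z≤n) (¬EdgeIn-nil (Q _))
Monitors⇒endpoint (suc d) {x} {y} {u} h mon with ≡-decᵛ _≟ᵇ_ u x | ≡-decᵛ _≟ᵇ_ u y
... | yes u≡x | _       = inj₁ u≡x
... | no _    | yes u≡y = inj₂ u≡y
... | no u≢x  | no u≢y  = ⊥-elim (two-first-steps (hamming≡suc⇒differ-at x y h))
  where
  on-first-step : lookup x i ≢ lookup y i → u ≡ flipAt i x
  on-first-step {i} xᵢ≢yᵢ with ≡-decᵛ _≟ᵇ_ u (flipAt i x)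
  ... | yes u≡flipᵢ = u≡flipᵢ
  ... | no u≢flipᵢ = ⊥-elim ([ u≢flipᵢ , u≢y ]
          (Monitors⇒endpoint d (hamming-flipAt-pred i x y xᵢ≢yᵢ h) (Monitors-flipAt i xᵢ≢yᵢ mon u≢x u≢flipᵢ)))

  two-first-steps : ¬ ∃ λ i → lookup x i ≢ lookup y i
  two-first-steps (i , xᵢ≢yᵢ)
    with another-difference xᵢ≢yᵢ (λ flipᵢ≡y → u≢y (trans (on-first-step xᵢ≢yᵢ) flipᵢ≡y))
  ... | j , i≢j , xⱼ≢yⱼ =
    i≢j (flipAt-injectiveˡ x (trans (sym (on-first-step xᵢ≢yᵢ)) (on-first-step xⱼ≢yⱼ)))

allBits : ∀ n → List (Vec Bool n)
allBits zero    = [] ∷ []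
allBits (suc n) = map (true ∷_) (allBits n) ++ map (false ∷_) (allBits n)

∈-allBits : ∀ (x : Vec Bool n) → x ∈ allBits n
∈-allBits []                  = here refl
∈-allBits {suc n} (true ∷ x)  = ∈-++⁺ˡ (∈-map⁺ (true ∷_) (∈-allBits x))
∈-allBits {suc n} (false ∷ x) = ∈-++⁺ʳ (map (true ∷_) (allBits n)) (∈-map⁺ (false ∷_) (∈-allBits x))

allBits-unique : ∀ n → Unique (allBits n)
allBits-unique zero    = All.[] ∷ []
allBits-unique (suc n) =
  Unique.++⁺ (Unique.map⁺ ∷-injectiveʳ (allBits-unique n))
             (Unique.map⁺ ∷-injectiveʳ (allBits-unique n))
             disjoint
  where
  disjoint : ∀ {x} → ¬ (x ∈ map (true ∷_) (allBits n) × x ∈ map (false ∷_) (allBits n))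
  disjoint (x∈true∷ , x∈false∷) with ∈-map⁻ (true ∷_) x∈true∷ | ∈-map⁻ (false ∷_) x∈false∷
  ... | _ , _ , refl | _ , _ , ()

length-allBits : ∀ n → length (allBits n) ≡ 2 ^ n
length-allBits zero    = refl
length-allBits (suc n) = begin
  length (map (true ∷_) (allBits n) ++ map (false ∷_) (allBits n))
    ≡⟨ length-++ (map (true ∷_) (allBits n)) ⟩
  length (map (true ∷_) (allBits n)) + length (map (false ∷_) (allBits n))
    ≡⟨ cong₂ _+_ (length-map (true ∷_) (allBits n)) (length-map (false ∷_) (allBits n)) ⟩
  length (allBits n) + length (allBits n)
    ≡⟨ cong₂ _+_ (length-allBits n) (length-allBits n) ⟩
  2 ^ n + 2 ^ n
    ≡⟨ cong (2 ^ n +_) (+-identityʳ (2 ^ n)) ⟨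
  2 ^ n + (2 ^ n + 0)
    ∎
  where open ≡-Reasoning

theorem6 : ∀ (n : ℕ) → 2 ≤ n → MEG≡ (Q n) (2 ^ n)
theorem6 zero    ()
theorem6 (suc n) _ = subst (MEG≡ (Q (suc n))) (length-allBits (suc n))
  (MEG≡-length (Q (suc n))
    adjacent-irreflexive
    (λ x → flipAt zero x , flipAt-adjacent zero x)
    (Monitors⇒endpoint _ refl)
    (allBits-unique (suc n))
    ∈-allBits)
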